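{- Let $H$ be a reflexive triangle-free graph and let $C$ be a non-contractible reduced closed walk in $H$ with basepoint $r$. Then $C$ decomposes uniquely as $C=\beta_T(C_f)$, where $C_f$ is a free-reduced closed walk and $T$ is a reduced walk from $r$ to the first vertex of $C_f$.
   Context: Walks in the reflexive graph $H$ are sequences $(x_0,\dots,x_\ell)$ of vertices with consecutive vertices adjacent (possibly equal); $(a,b)$-walks and closed walks with basepoint as usual. Concatenation $X\cdot Y$, reversal $\overleftarrow{X}$, $\beta_X(D)=X\cdot D\cdot\overleftarrow{X}$. $\Pi(H;a,b)$ is the graph on $(a,b)$-walks where $X=(x_0,\dots,x_\ell)$ and $Y$ are adjacent if (P1) $Y=(x_0,\dots,x_i,x_i,\dots,x_\ell)$, or (P2) $Y=(x_0,\dots,x_{i-1},x_i',x_{i+1},\dots,x_\ell)$ for some $0<i<\ell$ with $x_i'\sim x_i$ and $Y$ a walk (adjacency symmetric); $[X]$ is its component; $X$ is reduced if it is shortest in $[X]$; a closed walk $D$ at $r$ is contractible if $[D]$ contains the trivial walk $(r)$. $\Pi(H)$ is the graph obtained from the disjoint union over $r\in V(H)$ of $\Pi(H;r,r)$ by additionally joining $y$ and $x=(x_0,x_1,\dots,x_{\ell-1},x_0)$ whenever $x_1=x_{\ell-1}$ and $y=(x_1,\dots,x_{\ell-1})$. For a closed walk $D$, $\langle D\rangle$ denotes its component in $\Pi(H)$; $D$ is free-reduced if it is a shortest closed walk in $\langle D\rangle$. -}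

module Defs where

open import Level using (0ℓ)
open import Data.Nat using (ℕ; _≤_)
open import Data.Fin using (Fin)
open import Data.List using (List; []; _∷_; _++_; [_])
open import Data.List.NonEmpty as L⁺ using (List⁺; _∷_; head; last; toList; _⁺++_)
open import Data.List.Relation.Unary.Linked using (Linked)
open import Data.Product using (Σ; _×_; ∃; ∃-syntax)
open import Data.Sum using (_⊎_)
open import Relation.Nullary using (¬_)
open import Relation.Binary using (Rel; Reflexive; Symmetric; Decidable)
open import Relation.Binary.PropositionalEquality using (_≡_; _≢_)
open import Relation.Binary.Construct.Closure.ReflexiveTransitive using (Star)

record IsReflGraph {n : ℕ} (_~_ : Rel (Fin n) 0ℓ) : Set where
  field
    refl~ : Reflexive _~_
    sym~  : Symmetric _~_
    dec~  : Decidable _~_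

TriangleFree : {n : ℕ} → Rel (Fin n) 0ℓ → Set
TriangleFree {n} _~_ =
  (a b c : Fin n) → a ≢ b → b ≢ c → a ≢ c → a ~ b → b ~ c → a ~ c → Data.Empty.⊥
  where import Data.Empty

module WalkDefs {n : ℕ} (_~_ : Rel (Fin n) 0ℓ) where

  V : Set
  V = Fin n

  Seq : Set
  Seq = List⁺ V

  IsWalk : Seq → Set
  IsWalk X = Linked _~_ (toList X)

  len : Seq → ℕ
  len (_ ∷ xs) = Data.List.length xs

  IsWalkFromTo : V → V → Seq → Set
  IsWalkFromTo a b X = IsWalk X × head X ≡ a × last X ≡ b

  IsClosedWalk : Seq → Set
  IsClosedWalk X = IsWalk X × head X ≡ last X

  -- concatenation X · Y = (x₀,…,x_ℓ,y₁,…,y_m)  (used when last X = head Y)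
  _·_ : Seq → Seq → Seq
  X · (_ ∷ ys) = X ⁺++ ys

  rev : Seq → Seq
  rev = L⁺.reverse

  β : Seq → Seq → Seq
  β X D = (X · D) · rev X

  data Dup : List V → List V → Set where
    dup-here  : ∀ {x xs} → Dup (x ∷ xs) (x ∷ x ∷ xs)
    dup-there : ∀ {x xs ys} → Dup xs ys → Dup (x ∷ xs) (x ∷ ys)

  data ReplNonLast : List V → List V → Set where
    repl-here  : ∀ {x x' y zs} → x' ~ x → ReplNonLast (x ∷ y ∷ zs) (x' ∷ y ∷ zs)
    repl-there : ∀ {x xs ys} → ReplNonLast xs ys → ReplNonLast (x ∷ xs) (x ∷ ys)

  -- (P2): replace an interior vertex x_i (0 < i < ℓ) by x_i' ~ x_i
  data Repl : List V → List V → Set where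
    repl : ∀ {x xs ys} → ReplNonLast xs ys → Repl (x ∷ xs) (x ∷ ys)

  -- Edges of Π(H;a,b) (both moves preserve endpoints; both ends must be walks).
  PiEdge : Rel Seq 0ℓ
  PiEdge X Y = IsWalk X × IsWalk Y ×
    (Dup (toList X) (toList Y) ⊎ Dup (toList Y) (toList X) ⊎
     Repl (toList X) (toList Y) ⊎ Repl (toList Y) (toList X))

  SameClass : Rel Seq 0ℓ
  SameClass = Star PiEdge

  Reduced : Seq → Set
  Reduced X = ∀ Y → SameClass X Y → len X ≤ len Y

  Contractible : Seq → Set
  Contractible D = SameClass D (head D ∷ [])

  -- Extra edges of Π(H): y ~ x where x = (x₀,x₁,…,x_{ℓ-1},x₀), x₁ = x_{ℓ-1}, y = (x₁,…,x_{ℓ-1})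
  Shrink : Rel Seq 0ℓ
  Shrink X Y = IsWalk X × head Y ≡ last Y ×
    toList X ≡ head X ∷ (toList Y ++ [ head X ])

  FreeEdge : Rel Seq 0ℓ
  FreeEdge X Y = (IsClosedWalk X × IsClosedWalk Y × PiEdge X Y) ⊎ Shrink X Y ⊎ Shrink Y X

  FreeClass : Rel Seq 0ℓ
  FreeClass = Star FreeEdge

  FreeReduced : Seq → Set
  FreeReduced D = ∀ E → FreeClass D E → len D ≤ len E

  Decomp : V → Seq → Seq → Seq → Set
  Decomp r C T Cf =
    IsClosedWalk Cf × FreeReduced Cf ×
    IsWalkFromTo r (head Cf) T × Reduced T ×
    C ≡ β T Cf

-- Cancelling stutters x x and backtracks x y x with a stack gives a normal form `reduce` of vertex
-- sequences. In a triangle-free graph, replacing an interior vertex of a walk by a neighbour does not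
-- change this normal form, so it is an invariant of [X], and a walk is reduced iff it is locally reduced.
-- A locally reduced closed walk is uniquely u · f · reverse u with f cyclically reduced (its second and
-- penultimate vertices differ); conjugating by a vertex and reducing preserves the length of this core,
-- so |f| is an invariant of ⟨C⟩ bounding every length there from below, and f is free-reduced. Taking
-- T = u · (first vertex of f) gives C = β_T(f). Conversely a free-reduced closed walk cannot be shrunk,
-- and u · f · reverse u determines u and f among such f, which gives uniqueness.
module Submission where

open import Defs
open import Level using (0ℓ)
open import Data.Nat using (ℕ; suc; _≤_; _<_; z≤n; s≤s; s≤s⁻¹)
open import Data.Nat.Properties using (<⇒≱; ≤-refl; ≤-trans; ≤-reflexive; n≤1+n; module ≤-Reasoning)
open import Data.Fin using (Fin; _≟_)
open import Data.List using (List; []; _∷_; _++_; [_]; _∷ʳ_; length; foldr; reverse; initLast; _∷ʳ′_)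
open import Data.List.Properties
  using (++-assoc; ∷-injective; ∷-injectiveˡ; ∷-injectiveʳ; ∷ʳ-injectiveˡ; ∷ʳ-++;
         foldr-++; unfold-reverse; ++-identityʳ; reverse-++; length-++-≤ˡ; length-++-≤ʳ)
open import Data.List.NonEmpty as L⁺ using (List⁺; _∷_; head; last; toList; _⁺++_)
open import Data.List.NonEmpty.Properties using (toList-⁺++)
open import Data.List.Relation.Unary.Linked as Linked using (Linked; []; [-]; _∷_)
open import Data.Product using (_×_; ∃; ∃₂; ∃-syntax; _,_; proj₁; proj₂)
open import Data.Sum using (_⊎_; inj₁; inj₂)
open import Data.Empty using (⊥; ⊥-elim)
open import Data.Unit using (⊤; tt)
open import Function using (id)
open import Relation.Nullary using (¬_; yes; no)
open import Relation.Binary using (Rel; DecidableEquality)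
open import Relation.Binary.PropositionalEquality
  using (_≡_; _≢_; refl; sym; trans; cong; cong₂; subst; ≢-sym; module ≡-Reasoning)
import Relation.Binary.Construct.Closure.ReflexiveTransitive as Star
import Data.Vec as Vec
import Data.Vec.Properties as Vec

module _ {A : Set} where

  length-∷ʳ : ∀ (xs : List A) y → length (xs ∷ʳ y) ≡ suc (length xs)
  length-∷ʳ []       y = refl
  length-∷ʳ (_ ∷ xs) y = cong suc (length-∷ʳ xs y)

  ∷ʳ-∷ʳ-∷ʳ : ∀ (p : List A) a b c → p ∷ʳ a ∷ʳ b ∷ʳ c ≡ p ++ a ∷ b ∷ c ∷ []
  ∷ʳ-∷ʳ-∷ʳ p a b c = trans (∷ʳ-++ (p ∷ʳ a) b [ c ]) (∷ʳ-++ p a (b ∷ c ∷ []))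

  lastOr : A → List A → A
  lastOr d []       = d
  lastOr d (y ∷ ys) = lastOr y ys

  lastOr-++ : ∀ d xs y ys → lastOr d (xs ++ y ∷ ys) ≡ lastOr y ys
  lastOr-++ d []       y ys = refl
  lastOr-++ d (x ∷ xs) y ys = lastOr-++ x xs y ys

  lastOr-∷ʳ : ∀ d xs y → lastOr d (xs ∷ʳ y) ≡ y
  lastOr-∷ʳ d xs y = lastOr-++ d xs y []

  Closed : List A → Set
  Closed []       = ⊥
  Closed (x ∷ xs) = lastOr x xs ≡ x

  Fresh₂ : A → List A → Set
  Fresh₂ x []          = ⊤
  Fresh₂ x (y ∷ [])    = x ≢ y
  Fresh₂ x (y ∷ z ∷ _) = x ≢ y × x ≢ z

  LocallyReduced : List A → Set
  LocallyReduced []       = ⊤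
  LocallyReduced (x ∷ xs) = Fresh₂ x xs × LocallyReduced xs

  Fresh₂-++ˡ : ∀ x xs ys → Fresh₂ x (xs ++ ys) → Fresh₂ x xs
  Fresh₂-++ˡ x []          ys       _    = tt
  Fresh₂-++ˡ x (y ∷ [])    []       fx   = fx
  Fresh₂-++ˡ x (y ∷ [])    (_ ∷ _) fx   = proj₁ fx
  Fresh₂-++ˡ x (y ∷ z ∷ _) ys       fx   = fx

  reduced-++ˡ : ∀ xs ys → LocallyReduced (xs ++ ys) → LocallyReduced xs
  reduced-++ˡ []       ys _         = tt
  reduced-++ˡ (x ∷ xs) ys (fx , r) = Fresh₂-++ˡ x xs ys fx , reduced-++ˡ xs ys r

  reduced-++ʳ : ∀ xs ys → LocallyReduced (xs ++ ys) → LocallyReduced ys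
  reduced-++ʳ []       ys r       = r
  reduced-++ʳ (x ∷ xs) ys (_ , r) = reduced-++ʳ xs ys r

  Fresh₂-∷ʳ : ∀ x p a b c → Fresh₂ x (p ∷ʳ a ∷ʳ b) → Fresh₂ x (p ∷ʳ a ∷ʳ b ∷ʳ c)
  Fresh₂-∷ʳ x []          a b c fx = fx
  Fresh₂-∷ʳ x (_ ∷ [])    a b c fx = fx
  Fresh₂-∷ʳ x (_ ∷ _ ∷ _) a b c fx = fx

  reduced-∷ʳ : ∀ p a b x → LocallyReduced (p ∷ʳ a ∷ʳ b) → x ≢ a → x ≢ b →
               LocallyReduced (p ∷ʳ a ∷ʳ b ∷ʳ x)
  reduced-∷ʳ []      a b x (a≢b , _) x≢a x≢b = (a≢b , ≢-sym x≢a) , ≢-sym x≢b , tt , tt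
  reduced-∷ʳ (q ∷ p) a b x (fq , r)  x≢a x≢b =
    Fresh₂-∷ʳ q p a b x fq , reduced-∷ʳ p a b x r x≢a x≢b

  reduced-∷ʳ-backtrack : ∀ p a b c → LocallyReduced (p ∷ʳ a ∷ʳ b ∷ʳ c) → a ≢ c
  reduced-∷ʳ-backtrack []      a b c ((_ , a≢c) , _) = a≢c
  reduced-∷ʳ-backtrack (_ ∷ p) a b c (_ , r)         = reduced-∷ʳ-backtrack p a b c r

  wrap : A → List A → List A
  wrap x G = x ∷ (G ∷ʳ x)

  Closed-wrap : ∀ x G → Closed (wrap x G)
  Closed-wrap x G = lastOr-∷ʳ x G x

  wrap-reduced : ∀ x p a b → LocallyReduced (p ∷ʳ a ∷ʳ b) → Fresh₂ x (p ∷ʳ a ∷ʳ b) → x ≢ a → x ≢ b →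
                 LocallyReduced (wrap x (p ∷ʳ a ∷ʳ b))
  wrap-reduced x p a b r fx x≢a x≢b = Fresh₂-∷ʳ x p a b x fx , reduced-∷ʳ p a b x r x≢a x≢b

  conjugate : List A → List A → List A
  conjugate u f = u ++ f ++ reverse u

  conjugate-[] : ∀ f → conjugate [] f ≡ f
  conjugate-[] = ++-identityʳ

  conjugate-∷ : ∀ x u f → conjugate (x ∷ u) f ≡ wrap x (conjugate u f)
  conjugate-∷ x u f = cong (x ∷_) (begin
    u ++ f ++ reverse (x ∷ u)   ≡⟨ cong (λ r → u ++ f ++ r) (unfold-reverse x u) ⟩
    u ++ f ++ reverse u ∷ʳ x    ≡⟨ cong (u ++_) (++-assoc f (reverse u) [ x ]) ⟨
    u ++ (f ++ reverse u) ∷ʳ x  ≡⟨ ++-assoc u (f ++ reverse u) [ x ] ⟨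
    conjugate u f ∷ʳ x          ∎)
    where open ≡-Reasoning

  wrap-conjugate : ∀ y {H} u {f} → H ≡ conjugate u f → wrap y H ≡ conjugate (y ∷ u) f
  wrap-conjugate y {H} u {f} eq = trans (cong (wrap y) eq) (sym (conjugate-∷ y u f))

  length-conjugate : ∀ u f → length f ≤ length (conjugate u f)
  length-conjugate u f = ≤-trans (length-++-≤ˡ f) (length-++-≤ʳ (f ++ reverse u) {u})

  Closed-conjugate : ∀ u f → Closed f → Closed (conjugate u f)
  Closed-conjugate []      f c = subst Closed (sym (conjugate-[] f)) c
  Closed-conjugate (x ∷ u) f c = subst Closed (sym (conjugate-∷ x u f)) (Closed-wrap x (conjugate u f))

  data CyclicallyReduced : List A → Set where
    point : ∀ y → CyclicallyReduced [ y ]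
    loop  : ∀ {y s s'} m → s ≢ s' → CyclicallyReduced (wrap y (s ∷ (m ∷ʳ s')))

  cyclicallyReduced-closed : ∀ {f} → CyclicallyReduced f → Closed f
  cyclicallyReduced-closed (point y)                 = refl
  cyclicallyReduced-closed (loop {y} {s} {s'} m _) = Closed-wrap y (s ∷ (m ∷ʳ s'))

  rotate-reduced : ∀ {y s s'} m → s ≢ s' → LocallyReduced (wrap y (s ∷ (m ∷ʳ s'))) →
                   LocallyReduced (wrap s (m ∷ʳ s' ∷ʳ y)) × CyclicallyReduced (wrap s (m ∷ʳ s' ∷ʳ y))
  rotate-reduced {s' = s'} []      s≢s' ((y≢s , y≢s') , fs , r) =
    wrap-reduced _ [] s' _ r fs s≢s' (≢-sym y≢s) , loop [] (≢-sym y≢s')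
  rotate-reduced {s' = s'} (c ∷ m) s≢s' ((y≢s , y≢c) , fs , r) =
    wrap-reduced _ (c ∷ m) s' _ r fs s≢s' (≢-sym y≢s) , loop (m ∷ʳ s') (≢-sym y≢c)

  rotate⁻¹-cyclic : ∀ {y s s'} m → LocallyReduced (wrap y (s ∷ (m ∷ʳ s'))) →
                    CyclicallyReduced (wrap s' (y ∷ s ∷ m))
  rotate⁻¹-cyclic m r with initLast m
  ... | []      = loop [] (proj₁ (proj₁ r))
  rotate⁻¹-cyclic {y} {s} {s'} _ r | M ∷ʳ′ t =
    loop (s ∷ M) (≢-sym (reduced-∷ʳ-backtrack (y ∷ s ∷ M) t s' y r))

  Unshrinkable : List A → Set
  Unshrinkable f = ∀ a Y → Closed Y → f ≢ wrap a Y

  cyclicallyReduced-unshrinkable : ∀ {f} → CyclicallyReduced f → Unshrinkable f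
  cyclicallyReduced-unshrinkable (point y) a []      () _
  cyclicallyReduced-unshrinkable (point y) a (_ ∷ _) _  ()
  cyclicallyReduced-unshrinkable (loop {y} {s} {s'} m s≢s') a Y c eq
    with refl ← ∷ʳ-injectiveˡ (s ∷ (m ∷ʳ s')) Y (∷-injectiveʳ eq)
    = s≢s' (sym (trans (sym (lastOr-∷ʳ s m s')) c))

  conjugate-injective : ∀ {f f'} → Closed f → Closed f' → Unshrinkable f → Unshrinkable f' →
                        ∀ u u' → conjugate u f ≡ conjugate u' f' → u ≡ u' × f ≡ f'
  conjugate-injective {f} {f'} c c' ns ns' = go
    where
      go : ∀ u u' → conjugate u f ≡ conjugate u' f' → u ≡ u' × f ≡ f'
      go []      []        eq = refl , trans (sym (conjugate-[] f)) (trans eq (conjugate-[] f'))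
      go []      (x' ∷ u') eq = ⊥-elim (ns x' (conjugate u' f') (Closed-conjugate u' f' c')
        (trans (sym (conjugate-[] f)) (trans eq (conjugate-∷ x' u' f'))))
      go (x ∷ u) []        eq = ⊥-elim (ns' x (conjugate u f) (Closed-conjugate u f c)
        (trans (sym (conjugate-[] f')) (trans (sym eq) (conjugate-∷ x u f))))
      go (x ∷ u) (x' ∷ u') eq
        with refl , eq' ← ∷-injective (trans (sym (conjugate-∷ x u f)) (trans eq (conjugate-∷ x' u' f')))
        with refl , refl ← go u u' (∷ʳ-injectiveˡ (conjugate u f) (conjugate u' f') eq')
        = refl , refl

  last-lastOr : ∀ x (xs : List A) → last (x ∷ xs) ≡ lastOr x xs
  last-lastOr x xs with initLast xs
  ... | []       = refl
  ... | ys ∷ʳ′ y = sym (lastOr-∷ʳ x ys y)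

  toList-∷ʳ : ∀ (u : List A) a → toList (u L⁺.∷ʳ a) ≡ u ∷ʳ a
  toList-∷ʳ []      a = refl
  toList-∷ʳ (_ ∷ _) a = refl

  last-∷ʳ : ∀ (u : List A) a → last (u L⁺.∷ʳ a) ≡ a
  last-∷ʳ []      a = refl
  last-∷ʳ (x ∷ u) a = trans (last-lastOr x (u ∷ʳ a)) (lastOr-∷ʳ x u a)

  toList-reverse : ∀ (X : List⁺ A) → toList (L⁺.reverse X) ≡ reverse (toList X)
  toList-reverse (x ∷ xs) = begin
    toList (L⁺.fromVec (Vec.reverse v))  ≡⟨ toList-fromVec (Vec.reverse v) ⟩
    Vec.toList (Vec.reverse v)           ≡⟨ Vec.toList-reverse v ⟩
    reverse (Vec.toList v)               ≡⟨ cong (λ l → reverse (x ∷ l)) (Vec.toList∘fromList xs) ⟩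
    reverse (x ∷ xs)                     ∎
    where
      open ≡-Reasoning
      v = x Vec.∷ Vec.fromList xs
      toList-fromVec : ∀ {m} (w : Vec.Vec A (suc m)) → toList (L⁺.fromVec w) ≡ Vec.toList w
      toList-fromVec (_ Vec.∷ _) = refl

  toList-injective : ∀ {X Y : List⁺ A} → toList X ≡ toList Y → X ≡ Y
  toList-injective {_ ∷ _} {_ ∷ _} refl = refl

  head-toList-++ : ∀ {X Y : List⁺ A} zs → toList X ≡ toList Y ++ zs → head X ≡ head Y
  head-toList-++ {_ ∷ _} {_ ∷ _} zs eq = ∷-injectiveˡ eq

  module _ {R : Rel A 0ℓ} where

    linked-++ˡ : ∀ xs ys → Linked R (xs ++ ys) → Linked R xs
    linked-++ˡ []           ys _         = []
    linked-++ˡ (x ∷ [])     ys _         = [-]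
    linked-++ˡ (x ∷ y ∷ xs) ys (r ∷ rs) = r ∷ linked-++ˡ (y ∷ xs) ys rs

    linked-++ʳ : ∀ xs ys → Linked R (xs ++ ys) → Linked R ys
    linked-++ʳ []       ys rs = rs
    linked-++ʳ (x ∷ xs) ys rs = linked-++ʳ xs ys (Linked.tail rs)

module Reduction {A : Set} (_≟_ : DecidableEquality A) where

  push≢ : A → A → List A → List A
  push≢ x y []      = x ∷ y ∷ []
  push≢ x y (z ∷ s) with x ≟ z
  ... | yes _ = z ∷ s
  ... | no _  = x ∷ y ∷ z ∷ s

  -- Cons onto a locally reduced list, cancelling the stutter or backtrack this creates.
  push : A → List A → List A
  push x []      = x ∷ []
  push x (y ∷ s) with x ≟ y
  ... | yes _ = y ∷ s
  ... | no _  = push≢ x y s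

  reduce : List A → List A
  reduce = foldr push []

  push-stutter : ∀ x s → push x (x ∷ s) ≡ x ∷ s
  push-stutter x s with x ≟ x
  ... | yes _ = refl
  ... | no x≢x = ⊥-elim (x≢x refl)

  push-≢ : ∀ {x y} s → x ≢ y → push x (y ∷ s) ≡ push≢ x y s
  push-≢ {x} {y} s x≢y with x ≟ y
  ... | yes x≡y = ⊥-elim (x≢y x≡y)
  ... | no _    = refl

  push≢-backtrack : ∀ x y s → push≢ x y (x ∷ s) ≡ x ∷ s
  push≢-backtrack x y s with x ≟ x
  ... | yes _ = refl
  ... | no x≢x = ⊥-elim (x≢x refl)

  push≢-≢ : ∀ {x z} y s → x ≢ z → push≢ x y (z ∷ s) ≡ x ∷ y ∷ z ∷ s
  push≢-≢ {x} {z} y s x≢z with x ≟ z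
  ... | yes x≡z = ⊥-elim (x≢z x≡z)
  ... | no _    = refl

  push-fresh : ∀ x w → Fresh₂ x w → push x w ≡ x ∷ w
  push-fresh x []          _             = refl
  push-fresh x (y ∷ [])    x≢y           = push-≢ [] x≢y
  push-fresh x (y ∷ z ∷ w) (x≢y , x≢z) = trans (push-≢ (z ∷ w) x≢y) (push≢-≢ y w x≢z)

  push-∷ : ∀ x s → ∃ λ s' → push x s ≡ x ∷ s'
  push-∷ x []      = [] , refl
  push-∷ x (y ∷ s) with x ≟ y
  ... | yes refl = s , refl
  ... | no _ with s
  ...   | []     = y ∷ [] , refl
  ...   | z ∷ s' with x ≟ z
  ...     | yes refl = s' , refl
  ...     | no _     = y ∷ z ∷ s' , refl

  push-reduced : ∀ x s → LocallyReduced s → LocallyReduced (push x s)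
  push-reduced x []      _ = tt , tt
  push-reduced x (y ∷ s) r with x ≟ y
  ... | yes refl = r
  ... | no x≢y with s
  ...   | []     = x≢y , tt , tt
  ...   | z ∷ s' with x ≟ z
  ...     | yes refl = proj₂ r
  ...     | no x≢z   = (x≢y , x≢z) , r

  foldr-push-reduced : ∀ s xs → LocallyReduced s → LocallyReduced (foldr push s xs)
  foldr-push-reduced s []       r = r
  foldr-push-reduced s (x ∷ xs) r = push-reduced x _ (foldr-push-reduced s xs r)

  reduce-reduced : ∀ xs → LocallyReduced (reduce xs)
  reduce-reduced xs = foldr-push-reduced [] xs tt

  reduce-id : ∀ w → LocallyReduced w → reduce w ≡ w
  reduce-id []       _        = refl
  reduce-id (x ∷ w) (fx , r) = trans (cong (push x) (reduce-id w r)) (push-fresh x w fx)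

  push-idem : ∀ x s → push x (push x s) ≡ push x s
  push-idem x s with push-∷ x s
  ... | s' , eq rewrite eq = push-stutter x s'

  push-backtrack : ∀ a b s → LocallyReduced (a ∷ s) → push a (push b (a ∷ s)) ≡ a ∷ s
  push-backtrack a b s r with b ≟ a
  ... | yes refl = push-stutter a s
  ... | no b≢a with s
  ...   | []    = trans (push-≢ (a ∷ []) (≢-sym b≢a)) (push≢-backtrack a b [])
  ...   | z ∷ s' with b ≟ z
  ...     | no _     = trans (push-≢ (a ∷ z ∷ s') (≢-sym b≢a)) (push≢-backtrack a b (z ∷ s'))
  ...     | yes refl with s'
  ...       | []     = push-≢ [] (≢-sym b≢a)
  ...       | w ∷ s'' = trans (push-≢ (w ∷ s'') (≢-sym b≢a)) (push≢-≢ b s'' (proj₂ (proj₁ r)))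

  foldr-push-push : ∀ s x w → LocallyReduced s → foldr push s (push x w) ≡ push x (foldr push s w)
  foldr-push-push s x []      r = refl
  foldr-push-push s x (y ∷ w) r with x ≟ y
  ... | yes refl = sym (push-idem x (foldr push s w))
  ... | no _ with w
  ...   | []     = refl
  ...   | z ∷ w' with x ≟ z
  ...     | no _     = refl
  ...     | yes refl with push-∷ x (foldr push s w') | push-reduced x _ (foldr-push-reduced s w' r)
  ...       | t , eq | rt rewrite eq = sym (push-backtrack x y t rt)

  foldr-push-reduce : ∀ s xs → LocallyReduced s → foldr push s xs ≡ foldr push s (reduce xs)
  foldr-push-reduce s []       r = refl
  foldr-push-reduce s (x ∷ xs) r =
    trans (cong (push x) (foldr-push-reduce s xs r)) (sym (foldr-push-push s x (reduce xs) r))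

  reduce-++ : ∀ p q → reduce (p ++ q) ≡ foldr push (reduce q) p
  reduce-++ p q = foldr-++ push [] p q

  reduce-stutter : ∀ p a s → reduce (p ++ a ∷ a ∷ s) ≡ reduce (p ++ a ∷ s)
  reduce-stutter p a s = begin
    reduce (p ++ a ∷ a ∷ s)              ≡⟨ reduce-++ p (a ∷ a ∷ s) ⟩
    foldr push (push a (push a (reduce s))) p ≡⟨ cong (λ t → foldr push t p) (push-idem a (reduce s)) ⟩
    foldr push (push a (reduce s)) p     ≡⟨ reduce-++ p (a ∷ s) ⟨
    reduce (p ++ a ∷ s)                  ∎
    where open ≡-Reasoning

  reduce-backtrack : ∀ p a b s → reduce (p ++ a ∷ b ∷ a ∷ s) ≡ reduce (p ++ a ∷ s)
  reduce-backtrack p a b s = begin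
    reduce (p ++ a ∷ b ∷ a ∷ s)                    ≡⟨ reduce-++ p (a ∷ b ∷ a ∷ s) ⟩
    foldr push (push a (push b (push a (reduce s)))) p ≡⟨ cong (λ t → foldr push t p) cancel ⟩
    foldr push (push a (reduce s)) p               ≡⟨ reduce-++ p (a ∷ s) ⟨
    reduce (p ++ a ∷ s)                            ∎
    where
      open ≡-Reasoning
      cancel : push a (push b (push a (reduce s))) ≡ push a (reduce s)
      cancel with push-∷ a (reduce s) | push-reduced a _ (reduce-reduced s)
      ... | t , eq | rt rewrite eq = push-backtrack a b t rt

  push-length : ∀ x s → length (push x s) ≤ suc (length s)
  push-length x []      = s≤s z≤n
  push-length x (y ∷ s) with x ≟ y
  ... | yes _ = n≤1+n _
  ... | no _ with s
  ...   | []     = ≤-refl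
  ...   | z ∷ s' with x ≟ z
  ...     | yes _ = ≤-trans (n≤1+n _) (n≤1+n _)
  ...     | no _  = ≤-refl

  reduce-length : ∀ xs → length (reduce xs) ≤ length xs
  reduce-length []       = z≤n
  reduce-length (x ∷ xs) = ≤-trans (push-length x (reduce xs)) (s≤s (reduce-length xs))

  Degenerate : A → A → A → Set
  Degenerate a b c = b ≡ a ⊎ b ≡ c ⊎ a ≡ c

  degenerate? : ∀ a b c → Degenerate a b c ⊎ (b ≢ a × b ≢ c × a ≢ c)
  degenerate? a b c with b ≟ a | b ≟ c | a ≟ c
  ... | yes b≡a | _       | _       = inj₁ (inj₁ b≡a)
  ... | no _    | yes b≡c | _       = inj₁ (inj₂ (inj₁ b≡c))
  ... | no _    | no _    | yes a≡c = inj₁ (inj₂ (inj₂ a≡c))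
  ... | no b≢a  | no b≢c  | no a≢c  = inj₂ (b≢a , b≢c , a≢c)

  push-degenerate : ∀ a b c s → LocallyReduced (c ∷ s) → Degenerate a b c →
                    push a (push b (c ∷ s)) ≡ push a (c ∷ s)
  push-degenerate a .a c  s r (inj₁ refl)         = push-idem a (c ∷ s)
  push-degenerate a b  .b s r (inj₂ (inj₁ refl))  = cong (push a) (push-stutter b s)
  push-degenerate a b  .a s r (inj₂ (inj₂ refl))  = trans (push-backtrack a b s r) (sym (push-stutter a s))

  push-lastOr : ∀ d x y s → lastOr d (push x (y ∷ s)) ≡ lastOr y s
  push-lastOr d x y s with x ≟ y
  ... | yes _ = refl
  ... | no _ with s
  ...   | []     = refl
  ...   | z ∷ s' with x ≟ z
  ...     | yes _ = refl
  ...     | no _  = refl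

  reduce-lastOr : ∀ d x xs → lastOr d (reduce (x ∷ xs)) ≡ lastOr x xs
  reduce-lastOr d x []       = refl
  reduce-lastOr d x (y ∷ xs) with push-∷ y (reduce xs) | reduce-lastOr y y xs
  ... | t , eq | ih rewrite eq = trans (push-lastOr d x y t) ih

  reduce-closed : ∀ w → Closed w → Closed (reduce w)
  reduce-closed (x ∷ xs) c with push-∷ x (reduce xs) | reduce-lastOr x x xs
  ... | t , eq | l rewrite eq = trans l c

  -- Peel matching first and last vertices y s … s y until the second and penultimate vertices differ.
  core : ∀ w → LocallyReduced w → Closed w → ∃₂ λ u f → w ≡ conjugate u f × CyclicallyReduced f
  core w = peel (length w) w ≤-refl
    where
      peel : ∀ k w → length w ≤ k → LocallyReduced w → Closed w →
             ∃₂ λ u f → w ≡ conjugate u f × CyclicallyReduced f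
      peel k (y ∷ ws) _ r c with initLast ws
      ... | [] = [] , [ y ] , refl , point y
      ... | vs ∷ʳ′ z with trans (sym (lastOr-∷ʳ y vs z)) c
      peel k (y ∷ _) _ r c | [] ∷ʳ′ _ | refl = ⊥-elim (proj₁ r refl)
      peel k (y ∷ _) _ r c | (s ∷ vs) ∷ʳ′ _ | refl with initLast vs
      peel k (y ∷ _) _ r c | (s ∷ _) ∷ʳ′ _ | refl | [] = ⊥-elim (proj₂ (proj₁ r) refl)
      peel k (y ∷ _) _ r c | (s ∷ _) ∷ʳ′ _ | refl | m ∷ʳ′ s' with s ≟ s'
      ... | no s≢s' = [] , _ , sym (conjugate-[] _) , loop m s≢s'
      peel (suc k) (y ∷ _) (s≤s l) r c | (s ∷ _) ∷ʳ′ _ | refl | m ∷ʳ′ _ | yes refl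
        with u , f , eq , cr ← peel k (s ∷ (m ∷ʳ s))
                                 (≤-trans (n≤1+n _) (subst (_≤ k) (length-∷ʳ (s ∷ (m ∷ʳ s)) y) l))
                                 (reduced-++ˡ (s ∷ (m ∷ʳ s)) [ y ] (proj₂ r)) (Closed-wrap s m)
        = y ∷ u , f , wrap-conjugate y u eq , cr

  HasCore : List A → ℕ → Set
  HasCore w k = ∃₂ λ u f → w ≡ conjugate u f × CyclicallyReduced f × length f ≡ k

  HasCore-unique : ∀ {w k k'} → HasCore w k → HasCore w k' → k ≡ k'
  HasCore-unique (u , f , eq , cr , refl) (u' , f' , eq' , cr' , refl)
    with refl , refl ← conjugate-injective (cyclicallyReduced-closed cr) (cyclicallyReduced-closed cr')
                         (cyclicallyReduced-unshrinkable cr) (cyclicallyReduced-unshrinkable cr')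
                         u u' (trans (sym eq) eq')
    = refl

  reduce-hasCore : ∀ w → Closed w → ∃ (HasCore (reduce w))
  reduce-hasCore w c with u , f , eq , cr ← core (reduce w) (reduce-reduced w) (reduce-closed w c) =
    length f , u , f , eq , cr , refl

  reduced-hasCore : ∀ {w} u {f} → LocallyReduced w → w ≡ conjugate u f → CyclicallyReduced f →
                    HasCore (reduce w) (length f)
  reduced-hasCore u {f} r eq cr = u , f , trans (reduce-id _ r) eq , cr , refl

  reduce-wrap : ∀ x Z → reduce (wrap x Z) ≡ reduce (wrap x (reduce Z))
  reduce-wrap x Z = cong (push x) (begin
    reduce (Z ∷ʳ x)               ≡⟨ reduce-++ Z [ x ] ⟩
    foldr push [ x ] Z            ≡⟨ foldr-push-reduce [ x ] Z (tt , tt) ⟩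
    foldr push [ x ] (reduce Z)   ≡⟨ reduce-++ (reduce Z) [ x ] ⟨
    reduce (reduce Z ∷ʳ x)        ∎)
    where open ≡-Reasoning

  reduce-wrap-stutter : ∀ y H → reduce (wrap y (wrap y H)) ≡ reduce (wrap y H)
  reduce-wrap-stutter y H = begin
    reduce (y ∷ y ∷ (H ∷ʳ y ∷ʳ y))  ≡⟨ reduce-stutter [] y (H ∷ʳ y ∷ʳ y) ⟩
    reduce (y ∷ (H ∷ʳ y ∷ʳ y))      ≡⟨ cong (λ t → reduce (y ∷ t)) (∷ʳ-++ H y [ y ]) ⟩
    reduce ((y ∷ H) ++ y ∷ y ∷ [])   ≡⟨ reduce-stutter (y ∷ H) y [] ⟩
    reduce (wrap y H)                ∎
    where open ≡-Reasoning

  reduce-wrap-backtrack : ∀ x y W → reduce (wrap x (wrap y (wrap x W))) ≡ reduce (wrap x W)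
  reduce-wrap-backtrack x y W = begin
    reduce (x ∷ y ∷ x ∷ (W ∷ʳ x ∷ʳ y ∷ʳ x))  ≡⟨ reduce-backtrack [] x y (W ∷ʳ x ∷ʳ y ∷ʳ x) ⟩
    reduce (x ∷ (W ∷ʳ x ∷ʳ y ∷ʳ x))          ≡⟨ cong (λ t → reduce (x ∷ t)) (∷ʳ-∷ʳ-∷ʳ W x y x) ⟩
    reduce ((x ∷ W) ++ x ∷ y ∷ x ∷ [])        ≡⟨ reduce-backtrack (x ∷ W) x y [] ⟩
    reduce (wrap x W)                         ∎
    where open ≡-Reasoning

  hasCore-cyclic : ∀ {W f k} → W ≡ reduce f → LocallyReduced f → CyclicallyReduced f → length f ≡ k →
                   HasCore W k
  hasCore-cyclic {f = f} eq r cr l = [] , f , trans eq (trans (reduce-id f r) (sym (conjugate-[] f))) , cr , l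

  hasCore-wrap-cyclic : ∀ x {f} → CyclicallyReduced f → LocallyReduced f →
                        HasCore (reduce (wrap x f)) (length f)
  hasCore-wrap-cyclic x (point y) _ = hasCore-cyclic (reduce-backtrack [] x y []) (tt , tt) (point x) refl
  hasCore-wrap-cyclic x (loop {y} {s} {s'} m s≢s') r with x ≟ y | x ≟ s | x ≟ s'
  ... | yes refl | _ | _ = hasCore-cyclic (reduce-wrap-stutter x (s ∷ (m ∷ʳ s'))) r (loop m s≢s') refl
  ... | no _ | yes refl | _ with rotated , cr ← rotate-reduced m s≢s' r =
    hasCore-cyclic (reduce-backtrack [] x y (m ∷ʳ s' ∷ʳ y ∷ʳ x)) rotated cr
      (cong suc (length-∷ʳ (m ∷ʳ s' ∷ʳ y) x))
  ... | no x≢y | no x≢s | yes refl =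
    hasCore-cyclic cancel ((x≢y , ≢-sym s≢s') , reduced-++ˡ (y ∷ s ∷ (m ∷ʳ x)) [ y ] r)
      (rotate⁻¹-cyclic m r)
      (sym (cong (λ k → suc (suc k)) (length-∷ʳ (m ∷ʳ x) y)))
    where
      cancel : reduce (x ∷ y ∷ s ∷ (m ∷ʳ x ∷ʳ y ∷ʳ x)) ≡ reduce (x ∷ y ∷ s ∷ (m ∷ʳ x))
      cancel = trans (cong (λ t → reduce (x ∷ y ∷ s ∷ t)) (∷ʳ-∷ʳ-∷ʳ m x y x))
                     (reduce-backtrack (x ∷ y ∷ s ∷ m) x y [])
  ... | no x≢y | no x≢s | no x≢s' =
    reduced-hasCore [ x ] (wrap-reduced x (y ∷ s ∷ m) s' y r (x≢y , x≢s) x≢s' x≢y)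
      (sym (trans (conjugate-∷ x [] f) (cong (wrap x) (conjugate-[] f)))) (loop m s≢s')
    where f = wrap y (s ∷ (m ∷ʳ s'))

  hasCore-wrap-wrap : ∀ x y H u {f} → H ≡ conjugate u f → CyclicallyReduced f → LocallyReduced (wrap y H) →
                      HasCore (reduce (wrap x (wrap y H))) (length f)
  hasCore-wrap-wrap x y []        u {f} eq cr r =
    ⊥-elim (subst Closed (sym eq) (Closed-conjugate u f (cyclicallyReduced-closed cr)))
  hasCore-wrap-wrap x y (h ∷ W') u {f} eq cr r with initLast W'
  ... | [] = ⊥-elim (proj₂ (proj₁ r) refl)
  ... | W ∷ʳ′ h' with trans (sym (lastOr-∷ʳ h W h'))
                       (subst Closed (sym eq) (Closed-conjugate u f (cyclicallyReduced-closed cr)))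
  ...   | refl with x ≟ y | x ≟ h
  ...     | yes refl | _ =
    y ∷ u , f , trans (reduce-wrap-stutter y (wrap h W)) (trans (reduce-id _ r) (wrap-conjugate y u eq)) , cr , refl
  ...     | no _ | yes refl =
    u , f , trans (reduce-wrap-backtrack x y W) (trans (reduce-id _ (reduced-++ˡ (wrap x W) [ y ] (proj₂ r))) eq) ,
    cr , refl
  ...     | no x≢y | no x≢h =
    reduced-hasCore (x ∷ y ∷ u) (wrap-reduced x (y ∷ h ∷ W) h y r (x≢y , x≢h) x≢h x≢y)
      (wrap-conjugate x (y ∷ u) (wrap-conjugate y u eq)) cr

  hasCore-wrap : ∀ x {G k} → LocallyReduced G → HasCore G k → HasCore (reduce (wrap x G)) k
  hasCore-wrap x r ([]    , f , refl , cr , refl) =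
    subst (λ G → HasCore (reduce (wrap x G)) (length f)) (sym (conjugate-[] f))
      (hasCore-wrap-cyclic x cr (subst LocallyReduced (conjugate-[] f) r))
  hasCore-wrap x r (y ∷ u , f , refl , cr , refl) =
    subst (λ G → HasCore (reduce (wrap x G)) (length f)) (sym (conjugate-∷ y u f))
      (hasCore-wrap-wrap x y (conjugate u f) u refl cr (subst LocallyReduced (conjugate-∷ y u f) r))

module Walks {n : ℕ} (_~_ : Rel (Fin n) 0ℓ) where
  open WalkDefs _~_
  open Reduction {Fin n} _≟_

  toList-β : ∀ u a fs → toList (β (u L⁺.∷ʳ a) (a ∷ fs)) ≡ conjugate u (a ∷ fs)
  toList-β u a fs = begin
    toList ((T ⁺++ fs) · L⁺.reverse T)     ≡⟨ toList-· (T ⁺++ fs) (L⁺.reverse T) ⟩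
    toList (T ⁺++ fs) ++ L⁺.tail (L⁺.reverse T) ≡⟨ cong₂ _++_ (sym (toList-⁺++ T fs)) tail-reverse ⟩
    (toList T ++ fs) ++ reverse u          ≡⟨ cong (λ t → (t ++ fs) ++ reverse u) (toList-∷ʳ u a) ⟩
    (u ∷ʳ a ++ fs) ++ reverse u            ≡⟨ ++-assoc (u ∷ʳ a) fs (reverse u) ⟩
    u ∷ʳ a ++ fs ++ reverse u              ≡⟨ ∷ʳ-++ u a (fs ++ reverse u) ⟩
    conjugate u (a ∷ fs)                   ∎
    where
      open ≡-Reasoning
      T = u L⁺.∷ʳ a
      toList-· : ∀ X Y → toList (X · Y) ≡ toList X ++ L⁺.tail Y
      toList-· X (y ∷ ys) = sym (toList-⁺++ X ys)
      tail-reverse : L⁺.tail (L⁺.reverse T) ≡ reverse u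
      tail-reverse = ∷-injectiveʳ (begin
        toList (L⁺.reverse T)  ≡⟨ toList-reverse T ⟩
        reverse (toList T)     ≡⟨ cong reverse (toList-∷ʳ u a) ⟩
        reverse (u ∷ʳ a)       ≡⟨ reverse-++ u [ a ] ⟩
        a ∷ reverse u          ∎)

  closed-toList : ∀ (Y : Seq) → head Y ≡ last Y → Closed (toList Y)
  closed-toList (y ∷ ys) c = sym (trans c (last-lastOr y ys))

  reduce-Dup : ∀ {xs ys} → Dup xs ys → reduce xs ≡ reduce ys
  reduce-Dup (dup-here {x} {xs}) = sym (push-idem x (reduce xs))
  reduce-Dup (dup-there {x} d)   = cong (push x) (reduce-Dup d)

  hasCore-shrink : ∀ {X Y k} → Shrink X Y → HasCore (reduce (toList Y)) k → HasCore (reduce (toList X)) k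
  hasCore-shrink {x ∷ _} {Y} {k} (_ , _ , eq) hY =
    subst (λ w → HasCore (reduce w) k) (sym eq)
      (subst (λ w → HasCore w k) (sym (reduce-wrap x (toList Y))) (hasCore-wrap x (reduce-reduced (toList Y)) hY))

  hasCore-shrink⁻¹ : ∀ {X Y k} → Shrink X Y → HasCore (reduce (toList X)) k → HasCore (reduce (toList Y)) k
  hasCore-shrink⁻¹ {X} {Y} sh@(_ , cY , _) hX with k , hY ← reduce-hasCore (toList Y) (closed-toList Y cY)
    rewrite HasCore-unique hX (hasCore-shrink {X} {Y} sh hY) = hY

  freeReduced-unshrinkable : ∀ D → IsWalk D → FreeReduced D → Unshrinkable (toList D)
  freeReduced-unshrinkable (c ∷ cs) w fr a (y ∷ ys) cY eq with refl , eq' ← ∷-injective eq =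
    <⇒≱ shorter (fr (y ∷ ys) (inj₂ (inj₁ shrink) Star.◅ Star.ε))
    where
      shrink : Shrink (c ∷ cs) (y ∷ ys)
      shrink = w , sym (trans (last-lastOr y ys) cY) , cong (c ∷_) eq'
      shorter : length ys < length cs
      shorter = ≤-trans (n≤1+n _) (≤-reflexive (sym (trans (cong length eq') (cong suc (length-∷ʳ ys c)))))

  decomp-conjugate : ∀ {r C T Cf} → Decomp r C T Cf →
                     ∃ λ u → T ≡ u L⁺.∷ʳ head Cf × toList C ≡ conjugate u (toList Cf)
  decomp-conjugate {T = T} {Cf = a ∷ fs} (_ , _ , (_ , _ , lT) , _ , refl) with L⁺.snocView T
  -- Matching on snocView T also turns `last T` in the type of lT into b.
  ... | u L⁺.∷ʳ′ b with refl ← lT = u , refl , toList-β u a fs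

  decomposition-unique : ∀ {r C T Cf T' Cf'} → Decomp r C T Cf → Decomp r C T' Cf' → T ≡ T' × Cf ≡ Cf'
  decomposition-unique {Cf = Cf} {Cf' = Cf'} d@((w , c) , fr , _) d'@((w' , c') , fr' , _)
    with u , refl , eq ← decomp-conjugate d | u' , refl , eq' ← decomp-conjugate d'
    with refl , eqCf ← conjugate-injective (closed-toList Cf c) (closed-toList Cf' c')
                          (freeReduced-unshrinkable Cf w fr) (freeReduced-unshrinkable Cf' w' fr')
                          u u' (trans (sym eq) eq')
    with refl ← toList-injective {X = Cf} {Y = Cf'} eqCf
    = refl , refl

  module _ (G : IsReflGraph _~_) where
    open IsReflGraph G

    Move : V → Rel (List V) 0ℓ
    Move x xs ys = PiEdge (x ∷ xs) (x ∷ ys)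

    move-∷ : ∀ {x y xs ys} → x ~ y → Move y xs ys → Move x (y ∷ xs) (y ∷ ys)
    move-∷ x~y (w , w' , inj₁ d)                    = x~y ∷ w , x~y ∷ w' , inj₁ (dup-there d)
    move-∷ x~y (w , w' , inj₂ (inj₁ d))             = x~y ∷ w , x~y ∷ w' , inj₂ (inj₁ (dup-there d))
    move-∷ x~y (w , w' , inj₂ (inj₂ (inj₁ (repl r)))) =
      x~y ∷ w , x~y ∷ w' , inj₂ (inj₂ (inj₁ (repl (repl-there r))))
    move-∷ x~y (w , w' , inj₂ (inj₂ (inj₂ (repl r)))) =
      x~y ∷ w , x~y ∷ w' , inj₂ (inj₂ (inj₂ (repl (repl-there r))))

    stutter-move : ∀ {x xs} → Linked _~_ (x ∷ x ∷ xs) → Move x (x ∷ xs) xs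
    stutter-move w = w , Linked.tail w , inj₂ (inj₁ dup-here)

    -- x y x xs ⟶ x x x xs ⟶ x x xs ⟶ x xs
    backtrack-moves : ∀ {x y xs} → Linked _~_ (x ∷ y ∷ x ∷ xs) → Star.Star (Move x) (y ∷ x ∷ xs) xs
    backtrack-moves w@(x~y ∷ _ ∷ w') =
      (w , refl~ ∷ refl~ ∷ w' , inj₂ (inj₂ (inj₁ (repl (repl-here x~y))))) Star.◅
      stutter-move (refl~ ∷ refl~ ∷ w') Star.◅ stutter-move (refl~ ∷ w') Star.◅ Star.ε

    shorten : ∀ x xs → Linked _~_ (x ∷ xs) →
              LocallyReduced (x ∷ xs) ⊎ ∃ λ ys → Star.Star (Move x) xs ys × length ys < length xs
    shorten x []      _ = inj₁ (tt , tt)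
    shorten x (y ∷ []) w with x ≟ y
    ... | yes refl = inj₂ ([] , stutter-move w Star.◅ Star.ε , ≤-refl)
    ... | no x≢y   = inj₁ (x≢y , tt , tt)
    shorten x (y ∷ z ∷ xs) w@(x~y ∷ w') with x ≟ y | x ≟ z | shorten y (z ∷ xs) w'
    ... | yes refl | _        | _                   = inj₂ (z ∷ xs , stutter-move w Star.◅ Star.ε , ≤-refl)
    ... | no _     | yes refl | _                   = inj₂ (xs , backtrack-moves w , s≤s (n≤1+n _))
    ... | no x≢y   | no x≢z   | inj₁ r              = inj₁ ((x≢y , x≢z) , r)
    ... | no _     | no _     | inj₂ (ys , p , lt) =
      inj₂ (y ∷ ys , Star.gmap (y ∷_) (move-∷ x~y) p , s≤s lt)

    reduced⇒locallyReduced : ∀ X → IsWalk X → Reduced X → LocallyReduced (toList X)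
    reduced⇒locallyReduced (x ∷ xs) w rd with shorten x xs w
    ... | inj₁ r              = r
    ... | inj₂ (ys , p , lt) = ⊥-elim (<⇒≱ lt (rd (x ∷ ys) (Star.gmap (x ∷_) id p)))

    module _ (triangleFree : TriangleFree _~_) where

      degenerate-adjacent : ∀ {a b y} → Degenerate a b y → a ≢ y → a ~ b → b ~ y → a ~ y
      degenerate-adjacent (inj₁ refl)        _   _   b~y = b~y
      degenerate-adjacent (inj₂ (inj₁ refl)) _   a~b _   = a~b
      degenerate-adjacent (inj₂ (inj₂ a≡y))  a≢y _   _   = ⊥-elim (a≢y a≡y)

      -- Unless a x y and a x' y are both degenerate, a, x, x' and y contain a triangle.
      reduce-replace-here : ∀ {a x x' y zs} → x' ~ x →
                            Linked _~_ (a ∷ x ∷ y ∷ zs) → Linked _~_ (a ∷ x' ∷ y ∷ zs) →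
                            reduce (a ∷ x ∷ y ∷ zs) ≡ reduce (a ∷ x' ∷ y ∷ zs)
      reduce-replace-here {a} {x} {x'} {y} {zs} x'~x (a~x ∷ x~y ∷ _) (a~x' ∷ x'~y ∷ _)
        with push-∷ y (reduce zs) | push-reduced y _ (reduce-reduced zs)
      ... | t , eq | r rewrite eq with x ≟ x' | degenerate? a x y | degenerate? a x' y
      ... | yes refl | _ | _ = refl
      ... | no _ | inj₁ d | inj₁ d' = trans (push-degenerate a x y t r d) (sym (push-degenerate a x' y t r d'))
      ... | no _ | inj₁ d | inj₂ (x'≢a , x'≢y , a≢y) =
        ⊥-elim (triangleFree a x' y (≢-sym x'≢a) x'≢y a≢y a~x' x'~y (degenerate-adjacent d a≢y a~x x~y))
      ... | no _ | inj₂ (x≢a , x≢y , a≢y) | inj₁ d' =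
        ⊥-elim (triangleFree a x y (≢-sym x≢a) x≢y a≢y a~x x~y (degenerate-adjacent d' a≢y a~x' x'~y))
      ... | no x≢x' | inj₂ (x≢a , _ , _) | inj₂ (x'≢a , _ , _) =
        ⊥-elim (triangleFree a x x' (≢-sym x≢a) x≢x' (≢-sym x'≢a) a~x (sym~ x'~x) a~x')

      reduce-replace : ∀ a {xs ys} → ReplNonLast xs ys → Linked _~_ (a ∷ xs) → Linked _~_ (a ∷ ys) →
                       reduce (a ∷ xs) ≡ reduce (a ∷ ys)
      reduce-replace a (repl-here x'~x)   w       w'       = reduce-replace-here x'~x w w'
      reduce-replace a (repl-there {x} r) (_ ∷ w) (_ ∷ w') = cong (push a) (reduce-replace x r w w')

      reduce-PiEdge : ∀ {X Y} → PiEdge X Y → reduce (toList X) ≡ reduce (toList Y)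
      reduce-PiEdge (_ , _ , inj₁ d)                     = reduce-Dup d
      reduce-PiEdge (_ , _ , inj₂ (inj₁ d))              = sym (reduce-Dup d)
      reduce-PiEdge (w , w' , inj₂ (inj₂ (inj₁ (repl r)))) = reduce-replace _ r w w'
      reduce-PiEdge (w , w' , inj₂ (inj₂ (inj₂ (repl r)))) = sym (reduce-replace _ r w' w)

      reduce-SameClass : ∀ {X Y} → SameClass X Y → reduce (toList X) ≡ reduce (toList Y)
      reduce-SameClass Star.ε       = refl
      reduce-SameClass (e Star.◅ p) = trans (reduce-PiEdge e) (reduce-SameClass p)

      locallyReduced⇒reduced : ∀ X → LocallyReduced (toList X) → Reduced X
      locallyReduced⇒reduced X r Y p = s≤s⁻¹ (begin
        length (toList X)           ≡⟨ cong length (reduce-id (toList X) r) ⟨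
        length (reduce (toList X))  ≡⟨ cong length (reduce-SameClass p) ⟩
        length (reduce (toList Y))  ≤⟨ reduce-length (toList Y) ⟩
        length (toList Y)           ∎)
        where open ≤-Reasoning

      hasCore-FreeEdge : ∀ {X Y k} → FreeEdge X Y →
                         HasCore (reduce (toList X)) k → HasCore (reduce (toList Y)) k
      hasCore-FreeEdge {k = k} (inj₁ (_ , _ , e)) = subst (λ w → HasCore w k) (reduce-PiEdge e)
      hasCore-FreeEdge {X} {Y} (inj₂ (inj₁ sh))   = hasCore-shrink⁻¹ {X} {Y} sh
      hasCore-FreeEdge {X} {Y} (inj₂ (inj₂ sh))   = hasCore-shrink {Y} {X} sh

      hasCore-FreeClass : ∀ {X Y k} → FreeClass X Y →
                          HasCore (reduce (toList X)) k → HasCore (reduce (toList Y)) k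
      hasCore-FreeClass Star.ε       h = h
      hasCore-FreeClass (e Star.◅ p) h = hasCore-FreeClass p (hasCore-FreeEdge e h)

      cyclicallyReduced⇒freeReduced : ∀ D → LocallyReduced (toList D) → CyclicallyReduced (toList D) →
                                      FreeReduced D
      cyclicallyReduced⇒freeReduced D r cr E p
        with u , f , eq , _ , |f| ← hasCore-FreeClass p (reduced-hasCore [] r (sym (conjugate-[] _)) cr) =
        s≤s⁻¹ (begin
          length (toList D)           ≡⟨ |f| ⟨
          length f                    ≤⟨ length-conjugate u f ⟩
          length (conjugate u f)      ≡⟨ cong length eq ⟨
          length (reduce (toList E))  ≤⟨ reduce-length (toList E) ⟩
          length (toList E)           ∎)
        where open ≤-Reasoning

      decomposition : ∀ {r C} → IsWalkFromTo r r C → Reduced C → ∃₂ (Decomp r C)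
      decomposition {r} {C} (wC , hC , lC) rd
        with core (toList C) (reduced⇒locallyReduced C wC rd) (closed-toList C (trans hC (sym lC)))
      ... | u , [] , _ , ()
      ... | u , a ∷ fs , eq , cr =
        T , Cf , ((walk-Cf , closed-Cf) , free-Cf , (walk-T , head-T , last-∷ʳ u a) , reduced-T , C≡β)
        where
          T = u L⁺.∷ʳ a
          Cf : Seq
          Cf = a ∷ fs
          rest = fs ++ reverse u
          split : toList C ≡ toList T ++ rest
          split = trans eq (trans (sym (∷ʳ-++ u a rest)) (cong (_++ rest) (sym (toList-∷ʳ u a))))
          reduced-C : LocallyReduced (toList C)
          reduced-C = reduced⇒locallyReduced C wC rd
          walk-Cf : IsWalk Cf
          walk-Cf = linked-++ˡ (a ∷ fs) (reverse u) (linked-++ʳ u _ (subst (Linked _~_) eq wC))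
          closed-Cf : head Cf ≡ last Cf
          closed-Cf = sym (trans (last-lastOr a fs) (cyclicallyReduced-closed cr))
          free-Cf : FreeReduced Cf
          free-Cf = cyclicallyReduced⇒freeReduced Cf
            (reduced-++ˡ (a ∷ fs) (reverse u) (reduced-++ʳ u _ (subst LocallyReduced eq reduced-C))) cr
          walk-T : IsWalk T
          walk-T = linked-++ˡ (toList T) rest (subst (Linked _~_) split wC)
          head-T : head T ≡ r
          head-T = trans (sym (head-toList-++ {X = C} {Y = T} rest split)) hC
          reduced-T : Reduced T
          reduced-T = locallyReduced⇒reduced T (reduced-++ˡ (toList T) rest (subst LocallyReduced split reduced-C))
          C≡β : C ≡ β T Cf
          C≡β = toList-injective (trans eq (sym (toList-β u a fs)))

fact5p2 : {n : ℕ} (_~_ : Rel (Fin n) 0ℓ) → IsReflGraph _~_ → TriangleFree _~_ →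
    (r : Fin n) (C : WalkDefs.Seq _~_) →
    WalkDefs.IsWalkFromTo _~_ r r C → ¬ WalkDefs.Contractible _~_ C → WalkDefs.Reduced _~_ C →
    ∃[ T ] ∃[ Cf ] (WalkDefs.Decomp _~_ r C T Cf ×
      (∀ T' Cf' → WalkDefs.Decomp _~_ r C T' Cf' → T' ≡ T × Cf' ≡ Cf))
fact5p2 _~_ G triangleFree r C walk _ reduced
  with T , Cf , decomp ← Walks.decomposition _~_ G triangleFree walk reduced =
  T , Cf , decomp , λ _ _ decomp' → Walks.decomposition-unique _~_ decomp' decomp
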